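{- Let $D = K_4 - e$ be the diamond. Then $rb(K_n, D) \leq rb(K_n, K_{2,3})$ for all $n \geq 5$.
   Context: For a graph $H$ and an integer $n$, the rainbow number $rb(K_n,H)$ is the minimum number $m$ such that every edge-colouring of $K_n$ using at least $m$ colours contains a rainbow copy of $H$ (a subgraph isomorphic to $H$ whose edges all have distinct colours). $K_{2,3}$ is the complete bipartite graph with parts of sizes $2$ and $3$. -}

module Defs where

open import Data.Nat using (ℕ; _≤_; _<_)
open import Data.Fin using (Fin; zero; suc)
open import Data.Product using (_×_; _,_; Σ; proj₁; proj₂; ∃)
open import Data.List using (List; []; _∷_; map)
open import Data.List.Relation.Unary.Unique.Propositional using (Unique)
open import Relation.Binary.PropositionalEquality using (_≡_; _≢_)
open import Relation.Nullary using (¬_)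
open import Function.Definitions using (Injective)

-- A (simple) graph on vertex set Fin k, given by its list of edges,
-- each unordered edge listed exactly once as an ordered pair.
record Graph : Set where
  field
    size  : ℕ
    edges : List (Fin size × Fin size)
open Graph public

-- An edge-colouring of K_n: a symmetric colour assignment to pairs of
-- vertices (colours are natural numbers; values on the diagonal are irrelevant).
record Colouring (n : ℕ) : Set where
  field
    col : Fin n → Fin n → ℕ
    sym : ∀ i j → col i j ≡ col j i
open Colouring public

UsesAtLeast : ∀ {n} → Colouring n → ℕ → Set
UsesAtLeast {n} c m =
  Σ (Fin m → Fin n × Fin n) λ e →
    (∀ t → proj₁ (e t) ≢ proj₂ (e t)) ×
    Injective _≡_ _≡_ (λ t → col c (proj₁ (e t)) (proj₂ (e t)))

HasRainbowCopy : ∀ {n} → Colouring n → Graph → Set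
HasRainbowCopy {n} c H =
  Σ (Fin (size H) → Fin n) λ φ →
    Injective _≡_ _≡_ φ ×
    Unique (map (λ uv → col c (φ (proj₁ uv)) (φ (proj₂ uv))) (edges H))

Forces : Graph → ℕ → ℕ → Set
Forces H n m = (c : Colouring n) → UsesAtLeast c m → HasRainbowCopy c H

IsRainbowNumber : Graph → ℕ → ℕ → Set
IsRainbowNumber H n r = Forces H n r × (∀ m → m < r → ¬ Forces H n m)

v0 v1 v2 v3 v4 : Fin 5
v0 = zero
v1 = suc zero
v2 = suc (suc zero)
v3 = suc (suc (suc zero))
v4 = suc (suc (suc (suc zero)))

w0 w1 w2 w3 : Fin 4
w0 = zero
w1 = suc zero
w2 = suc (suc zero)
w3 = suc (suc (suc zero))

Diamond : Graph
Diamond = record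
  { size = 4
  ; edges = (w0 , w1) ∷ (w0 , w2) ∷ (w0 , w3) ∷ (w1 , w2) ∷ (w1 , w3) ∷ [] }

K23 : Graph
K23 = record
  { size = 5
  ; edges = (v0 , v2) ∷ (v0 , v3) ∷ (v0 , v4) ∷ (v1 , v2) ∷ (v1 , v3) ∷ (v1 , v4) ∷ [] }

-- A rainbow K₂,₃ with parts {a, b} and {x, y, z} spans three diamonds: the spine ab
-- together with the legs at two of x, y, z. Its six legs have distinct colours, so the
-- colour of ab repeats the colour of a leg at no more than one of x, y, z, and the
-- diamond avoiding that vertex is rainbow. Hence every colouring forcing a rainbow
-- K₂,₃ also forces a rainbow diamond, and minimality of rb(K_n, D) gives the bound.
module Submission where

open import Defs
open import Level using (Level)
open import Data.Nat using (ℕ; suc; _≤_; _≟_)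
open import Data.Nat.Properties using (≮⇒≥)
open import Data.Fin using (Fin; punchIn)
open import Data.Fin.Properties using (punchIn-injective)
open import Data.Product using (_,_)
open import Data.Sum using (_⊎_; inj₁; inj₂)
open import Data.List using (List; []; _∷_)
open import Data.List.Relation.Unary.All using (All; []; _∷_)
open import Data.List.Relation.Unary.AllPairs using ([]; _∷_)
open import Data.List.Relation.Unary.Unique.Propositional using (Unique)
open import Data.List.Relation.Binary.Sublist.Propositional using (_⊆_; []; _∷_; _∷ʳ_)
open import Data.List.Relation.Binary.Sublist.Propositional.Properties using (All-resp-⊆)
open import Function using (_∘_)
open import Function.Definitions using (Injective)
open import Relation.Binary.Definitions using (DecidableEquality)
open import Relation.Binary.PropositionalEquality using (_≡_; _≢_; refl; ≢-sym)
open import Relation.Nullary using (yes; no)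

private
  variable
    a : Level
    A : Set a

Unique-resp-⊇ : {xs ys : List A} → xs ⊆ ys → Unique ys → Unique xs
Unique-resp-⊇ []         []          = []
Unique-resp-⊇ (_ ∷ʳ p)   (_ ∷ u)     = Unique-resp-⊇ p u
Unique-resp-⊇ (refl ∷ p) (y∉ys ∷ u)  = All-resp-⊆ p y∉ys ∷ Unique-resp-⊇ p u

-- The six colours are those of the legs ax, ay, az, bx, by, bz of K₂,₃, in the order of its edge list.
spine-avoids-two-columns :
  DecidableEquality A → {ax ay az bx by bz : A} (κ : A) →
  Unique (ax ∷ ay ∷ az ∷ bx ∷ by ∷ bz ∷ []) →
  All (κ ≢_) (ax ∷ ay ∷ bx ∷ by ∷ []) ⊎
  All (κ ≢_) (ax ∷ az ∷ bx ∷ bz ∷ []) ⊎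
  All (κ ≢_) (ay ∷ az ∷ by ∷ bz ∷ [])
spine-avoids-two-columns _≟_ {ax} {ay} {_} {bx} {by} κ
  ((ax≢ay ∷ ax≢az ∷ _ ∷ ax≢by ∷ ax≢bz ∷ []) ∷
   (ay≢az ∷ ay≢bx ∷ _ ∷ ay≢bz ∷ []) ∷
   (az≢bx ∷ az≢by ∷ _ ∷ []) ∷
   (bx≢by ∷ bx≢bz ∷ []) ∷
   (by≢bz ∷ []) ∷ [] ∷ [])
  with κ ≟ ax | κ ≟ bx | κ ≟ ay | κ ≟ by
... | yes refl | _ | _ | _ =
  inj₂ (inj₂ (ax≢ay ∷ ax≢az ∷ ax≢by ∷ ax≢bz ∷ []))
... | _ | yes refl | _ | _ =
  inj₂ (inj₂ (≢-sym ay≢bx ∷ ≢-sym az≢bx ∷ bx≢by ∷ bx≢bz ∷ []))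
... | _ | _ | yes refl | _ =
  inj₂ (inj₁ (≢-sym ax≢ay ∷ ay≢az ∷ ay≢bx ∷ ay≢bz ∷ []))
... | _ | _ | _ | yes refl =
  inj₂ (inj₁ (≢-sym ax≢by ∷ ≢-sym az≢by ∷ ≢-sym bx≢by ∷ by≢bz ∷ []))
... | no κ≢ax | no κ≢bx | no κ≢ay | no κ≢by =
  inj₁ (κ≢ax ∷ κ≢ay ∷ κ≢bx ∷ κ≢by ∷ [])

∘punchIn-injective : ∀ {m} {φ : Fin (suc m) → A} → Injective _≡_ _≡_ φ →
                     ∀ t → Injective _≡_ _≡_ (φ ∘ punchIn t)
∘punchIn-injective φ-inj t = punchIn-injective t _ _ ∘ φ-inj

rainbowK₂₃⇒rainbowDiamond : ∀ {n} (c : Colouring n) → HasRainbowCopy c K23 → HasRainbowCopy c Diamond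
rainbowK₂₃⇒rainbowDiamond c (φ , φ-inj , legs)
  with spine-avoids-two-columns _≟_ (col c (φ v0) (φ v1)) legs
... | inj₁ κ∉xy =
  φ ∘ punchIn v4 , ∘punchIn-injective φ-inj v4 ,
  κ∉xy ∷ Unique-resp-⊇ (refl ∷ refl ∷ _ ∷ʳ refl ∷ refl ∷ _ ∷ʳ []) legs
... | inj₂ (inj₁ κ∉xz) =
  φ ∘ punchIn v3 , ∘punchIn-injective φ-inj v3 ,
  κ∉xz ∷ Unique-resp-⊇ (refl ∷ _ ∷ʳ refl ∷ refl ∷ _ ∷ʳ refl ∷ []) legs
... | inj₂ (inj₂ κ∉yz) =
  φ ∘ punchIn v2 , ∘punchIn-injective φ-inj v2 ,
  κ∉yz ∷ Unique-resp-⊇ (_ ∷ʳ refl ∷ refl ∷ _ ∷ʳ refl ∷ refl ∷ []) legs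

rainbowNumber-mono : ∀ {G H n r₁ r₂} →
  (∀ (c : Colouring n) → HasRainbowCopy c H → HasRainbowCopy c G) →
  IsRainbowNumber G n r₁ → IsRainbowNumber H n r₂ → r₁ ≤ r₂
rainbowNumber-mono H⇒G (_ , G-minimal) (H-forced , _) =
  ≮⇒≥ λ r₂<r₁ → G-minimal _ r₂<r₁ λ c → H⇒G c ∘ H-forced c

-- The argument works for every n.
lemma6 : (n : ℕ) → 5 ≤ n → (r₁ r₂ : ℕ) →
           IsRainbowNumber Diamond n r₁ → IsRainbowNumber K23 n r₂ → r₁ ≤ r₂
lemma6 _ _ _ _ = rainbowNumber-mono rainbowK₂₃⇒rainbowDiamond
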